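{- For fixed non-zero $z, q \in \mathbb{C}$ and all integers $h \geq 0$, the denominator convergent function $Q_h(q,z)$ defined in the context satisfies $$Q_h(q,z) = \sum_{0 \leq i \leq h} \begin{bmatrix} h \\ i \end{bmatrix}_{q^2} q^{(2h-1)i}(-z)^i.$$
   Context: For a fixed non-zero $q \in \mathbb{C}$ define, for integers $h \geq 0$, $c_h(q) = q^{2h-3}(q^{2h}+q^{2h-2}-1)$ if $h \geq 2$, $c_1(q) = q$, $c_0(q) = 1$; and $\alpha_h(q) = q^{6h-10}(q^{2h-2}-1)$ if $h \geq 2$, $\alpha_h(q)=0$ otherwise. Define $Q_0(q,z)=1$, $Q_1(q,z)=1-qz$, and for $h \geq 2$: $Q_h(q,z) = (1-c_h(q) z)Q_{h-1}(q,z) - \alpha_h(q) z^2 Q_{h-2}(q,z)$. The $q$-Pochhammer symbol is $(a;q)_n = \prod_{j=0}^{n-1}(1-aq^j)$ for $n \geq 1$ and $(a;q)_0=1$. The $q$-binomial (Gaussian) coefficient is $\begin{bmatrix} n \\ m \end{bmatrix}_q = \frac{(q;q)_n}{(q;q)_m (q;q)_{n-m}}$ for $0 \leq m \leq n$, and $0$ otherwise; $\begin{bmatrix} n \\ m \end{bmatrix}_{q^2}$ denotes this with $q$ replaced by $q^2$. -}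

module Defs where

open import Level using (Level)
open import Data.Nat as ℕ using (ℕ; zero; suc)
open import Algebra.Bundles using (CommutativeRing)

module _ {c ℓ : Level} (R : CommutativeRing c ℓ) where
  open CommutativeRing R

  pow : Carrier → ℕ → Carrier
  pow x zero    = 1#
  pow x (suc n) = x * pow x n

  -- c_h(q): c_0 = 1, c_1 = q, c_h = q^{2h-3}(q^{2h}+q^{2h-2}-1) for h ≥ 2
  -- (for h = k+2: 2h-3 = 2k+1, 2h = 2k+4, 2h-2 = 2k+2)
  cCoef : Carrier → ℕ → Carrier
  cCoef q zero          = 1#
  cCoef q (suc zero)    = q
  cCoef q (suc (suc k)) =
    pow q (1 ℕ.+ 2 ℕ.* k) * ((pow q (4 ℕ.+ 2 ℕ.* k) + pow q (2 ℕ.+ 2 ℕ.* k)) - 1#)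

  -- α_h(q) = q^{6h-10}(q^{2h-2}-1) for h ≥ 2, 0 otherwise
  -- (for h = k+2: 6h-10 = 6k+2, 2h-2 = 2k+2)
  αCoef : Carrier → ℕ → Carrier
  αCoef q zero          = 0#
  αCoef q (suc zero)    = 0#
  αCoef q (suc (suc k)) = pow q (2 ℕ.+ 6 ℕ.* k) * (pow q (2 ℕ.+ 2 ℕ.* k) - 1#)

  Q : Carrier → Carrier → ℕ → Carrier
  Q q z zero          = 1#
  Q q z (suc zero)    = 1# - q * z
  Q q z (suc (suc k)) =
    (1# - cCoef q (suc (suc k)) * z) * Q q z (suc k)
      - αCoef q (suc (suc k)) * (z * z) * Q q z k

  -- Over a field with (p;p)_n invertible this equals (p;p)_n / ((p;p)_m (p;p)_{n-m}),
  -- and it is 0 for m > n.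
  gauss : Carrier → ℕ → ℕ → Carrier
  gauss p n       zero    = 1#
  gauss p zero    (suc m) = 0#
  gauss p (suc n) (suc m) = gauss p n m + pow p (suc m) * gauss p n (suc m)

  sumTo : ℕ → (ℕ → Carrier) → Carrier
  sumTo zero    f = f 0
  sumTo (suc n) f = sumTo n f + f (suc n)

-- With p = q², the right-hand side is H_h(q^(2h-1) (-z)) for the Rogers–Szegő polynomial
-- H_n(x) = Σ_i [n,i]_p x^i. The q-Pascal rule defining gauss gives H_{n+1}(x) = H_n(px) + x H_n(x),
-- and induction on n turns this into H_{n+1}(px) = H_n(px) + p^(n+1) x H_n(x). Eliminating H_n(py)
-- and H_n(p²y) from these relations leaves a three-term recurrence between H_{n+2}(p²y),
-- H_{n+1}(py) and H_n(y); at y = q^(2h-5) (-z) its coefficients are exactly 1 - c_h z and -α_h z²,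
-- so the closed form obeys the recurrence defining Q_h.

module Submission where

open import Defs
open import Level using (Level)
open import Algebra.Bundles using (CommutativeRing)
open import Data.Nat as ℕ using (ℕ; zero; suc; s≤s)
import Data.Nat.Properties as ℕ
open import Data.Integer as ℤ using (ℤ; +_; -[1+_]; _⊖_)
import Data.Integer.Properties as ℤ
open import Data.Maybe using (Maybe; map)
open import Relation.Binary.Consequences using (dec⇒weaklyDec)
open import Relation.Binary.PropositionalEquality as ≡ using (_≡_)
open import Relation.Nullary using (¬_)
open import Function using (_∘_)

2[1+k]∸1≡1+2k : ∀ k → 2 ℕ.* suc k ℕ.∸ 1 ≡ suc (2 ℕ.* k)
2[1+k]∸1≡1+2k k = ℕ.+-suc k (k ℕ.+ 0)

-- The library's ring solvers for an arbitrary commutative ring either must decide equality in R or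
-- use ℕ coefficients (no subtraction); integer coefficients need the canonical map ℤ → R.
module IntegerCoefficientRingSolver {c ℓ : Level} (R : CommutativeRing c ℓ) where
  open CommutativeRing R
  open import Algebra.Properties.Ring ring using (-‿distribˡ-*; -‿distribʳ-*)
  open import Algebra.Properties.AbelianGroup +-abelianGroup
    using (ε⁻¹≈ε; ⁻¹-involutive; xyx⁻¹≈y; ⁻¹-∙-comm)
  open import Algebra.Properties.Semiring.Mult.TCOptimised semiring
    using (_×_; 1+×; ×-homo-+; ×1-homo-*)
  open import Algebra.Solver.Ring.AlmostCommutativeRing
    using (fromCommutativeRing; _-Raw-AlmostCommutative⟶_)
  open import Relation.Binary.Reasoning.Setoid setoid

  -- The optimised multiple makes ⟦ + 0 ⟧ and ⟦ + 1 ⟧ reduce to 0# and 1#, so that solver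
  -- equations written with con (+ 0) and con (+ 1) match goals mentioning 0# and 1#.
  ⟦_⟧ : ℤ → Carrier
  ⟦ + n ⟧      = n × 1#
  ⟦ -[1+ n ] ⟧ = - (suc n × 1#)

  ⟦-⟧ : ∀ i → ⟦ ℤ.- i ⟧ ≈ - ⟦ i ⟧
  ⟦-⟧ (+ zero)   = sym ε⁻¹≈ε
  ⟦-⟧ (+ suc n)  = refl
  ⟦-⟧ -[1+ n ]   = sym (⁻¹-involutive _)

  ⟦⊖⟧ : ∀ m n → ⟦ m ⊖ n ⟧ ≈ m × 1# - n × 1#
  ⟦⊖⟧ m       zero    = sym (trans (+-congˡ ε⁻¹≈ε) (+-identityʳ _))
  ⟦⊖⟧ zero    (suc n) = sym (+-identityˡ _)
  ⟦⊖⟧ (suc m) (suc n) = begin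
    ⟦ suc m ⊖ suc n ⟧                   ≡⟨ ≡.cong ⟦_⟧ (ℤ.[1+m]⊖[1+n]≡m⊖n m n) ⟩
    ⟦ m ⊖ n ⟧                           ≈⟨ ⟦⊖⟧ m n ⟩
    m × 1# - n × 1#                     ≈⟨ +-congʳ (xyx⁻¹≈y 1# (m × 1#)) ⟨
    1# + m × 1# - 1# - n × 1#           ≈⟨ +-assoc _ _ _ ⟩
    1# + m × 1# + (- 1# - n × 1#)       ≈⟨ +-congˡ (⁻¹-∙-comm 1# (n × 1#)) ⟩
    1# + m × 1# - (1# + n × 1#)         ≈⟨ +-cong (1+× m 1#) (-‿cong (1+× n 1#)) ⟨
    suc m × 1# - suc n × 1#             ∎

  ⟦+⟧ : ∀ i j → ⟦ i ℤ.+ j ⟧ ≈ ⟦ i ⟧ + ⟦ j ⟧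
  ⟦+⟧ (+ m)    (+ n)    = ×-homo-+ 1# m n
  ⟦+⟧ (+ m)    -[1+ n ] = ⟦⊖⟧ m (suc n)
  ⟦+⟧ -[1+ m ] (+ n)    = trans (⟦⊖⟧ n (suc m)) (+-comm _ _)
  ⟦+⟧ -[1+ m ] -[1+ n ] = begin
    - (suc (suc (m ℕ.+ n)) × 1#)        ≡⟨ ≡.cong (λ k → - (suc k × 1#)) (ℕ.+-suc m n) ⟨
    - ((suc m ℕ.+ suc n) × 1#)          ≈⟨ -‿cong (×-homo-+ 1# (suc m) (suc n)) ⟩
    - (suc m × 1# + suc n × 1#)         ≈⟨ ⁻¹-∙-comm _ _ ⟨
    - (suc m × 1#) - (suc n × 1#)       ∎

  ⟦*⟧ : ∀ i j → ⟦ i ℤ.* j ⟧ ≈ ⟦ i ⟧ * ⟦ j ⟧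
  ⟦*⟧ (+ m)    (+ n)    = trans (reflexive (≡.cong ⟦_⟧ (ℤ.+◃n≡+n (m ℕ.* n)))) (×1-homo-* m n)
  ⟦*⟧ (+ m)    -[1+ n ] = begin
    ⟦ + m ℤ.* -[1+ n ] ⟧                ≡⟨ ≡.cong ⟦_⟧ (ℤ.-◃n≡-n (m ℕ.* suc n)) ⟩
    ⟦ ℤ.- (+ (m ℕ.* suc n)) ⟧           ≈⟨ ⟦-⟧ (+ (m ℕ.* suc n)) ⟩
    - ((m ℕ.* suc n) × 1#)              ≈⟨ -‿cong (×1-homo-* m (suc n)) ⟩
    - (m × 1# * suc n × 1#)             ≈⟨ -‿distribʳ-* _ _ ⟩
    m × 1# * - (suc n × 1#)             ∎
  ⟦*⟧ -[1+ m ] (+ n)    = begin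
    ⟦ -[1+ m ] ℤ.* + n ⟧                ≡⟨ ≡.cong ⟦_⟧ (ℤ.-◃n≡-n (suc m ℕ.* n)) ⟩
    ⟦ ℤ.- (+ (suc m ℕ.* n)) ⟧           ≈⟨ ⟦-⟧ (+ (suc m ℕ.* n)) ⟩
    - ((suc m ℕ.* n) × 1#)              ≈⟨ -‿cong (×1-homo-* (suc m) n) ⟩
    - (suc m × 1# * n × 1#)             ≈⟨ -‿distribˡ-* _ _ ⟩
    - (suc m × 1#) * n × 1#             ∎
  ⟦*⟧ -[1+ m ] -[1+ n ] = begin
    (suc m ℕ.* suc n) × 1#              ≈⟨ ×1-homo-* (suc m) (suc n) ⟩
    suc m × 1# * suc n × 1#             ≈⟨ ⁻¹-involutive _ ⟨
    - - (suc m × 1# * suc n × 1#)       ≈⟨ -‿cong (-‿distribˡ-* _ _) ⟩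
    - (- (suc m × 1#) * suc n × 1#)     ≈⟨ -‿distribʳ-* _ _ ⟩
    - (suc m × 1#) * - (suc n × 1#)     ∎

  ℤ⟶R : ℤ.+-*-rawRing -Raw-AlmostCommutative⟶ fromCommutativeRing R
  ℤ⟶R = record
    { ⟦_⟧    = ⟦_⟧
    ; +-homo = ⟦+⟧
    ; *-homo = ⟦*⟧
    ; -‿homo = ⟦-⟧
    ; 0-homo = refl
    ; 1-homo = refl
    }

  ⟦⟧-weaklyDecidable : ∀ i j → Maybe (⟦ i ⟧ ≈ ⟦ j ⟧)
  ⟦⟧-weaklyDecidable i j = map (reflexive ∘ ≡.cong ⟦_⟧) (dec⇒weaklyDec ℤ._≟_ i j)

  open import Algebra.Solver.Ring ℤ.+-*-rawRing (fromCommutativeRing R) ℤ⟶R ⟦⟧-weaklyDecidable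
    public using (solve; _:=_; con; _:+_; _:*_; _:^_; :-_; _:-_)

module _ {c ℓ : Level} (R : CommutativeRing c ℓ) where
  open CommutativeRing R
  open IntegerCoefficientRingSolver R
  open import Algebra.Properties.CommutativeSemiring.Exp commutativeSemiring
    using (_^_; ^-congˡ; ^-assocʳ; ^-distrib-*)
  open import Relation.Binary.Reasoning.Setoid setoid

  pow≈^ : ∀ x n → pow R x n ≈ x ^ n
  pow≈^ x zero    = refl
  pow≈^ x (suc n) = *-congˡ (pow≈^ x n)

  pow-cong : ∀ {x y} n → x ≈ y → pow R x n ≈ pow R y n
  pow-cong {x} {y} n x≈y = begin
    pow R x n  ≈⟨ pow≈^ x n ⟩
    x ^ n      ≈⟨ ^-congˡ n x≈y ⟩
    y ^ n      ≈⟨ pow≈^ y n ⟨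
    pow R y n  ∎

  pow-distrib-* : ∀ x y n → pow R (x * y) n ≈ pow R x n * pow R y n
  pow-distrib-* x y n = begin
    pow R (x * y) n          ≈⟨ pow≈^ (x * y) n ⟩
    (x * y) ^ n              ≈⟨ ^-distrib-* x y n ⟩
    x ^ n * y ^ n            ≈⟨ *-cong (pow≈^ x n) (pow≈^ y n) ⟨
    pow R x n * pow R y n    ∎

  pow-* : ∀ x m n → pow R x (m ℕ.* n) ≈ pow R (pow R x m) n
  pow-* x m n = begin
    pow R x (m ℕ.* n)        ≈⟨ pow≈^ x (m ℕ.* n) ⟩
    x ^ (m ℕ.* n)            ≈⟨ ^-assocʳ x m n ⟨
    (x ^ m) ^ n              ≈⟨ ^-congˡ n (pow≈^ x m) ⟨
    pow R x m ^ n            ≈⟨ pow≈^ (pow R x m) n ⟨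
    pow R (pow R x m) n      ∎

  sumTo-cong : ∀ n {f g : ℕ → Carrier} → (∀ i → f i ≈ g i) → sumTo R n f ≈ sumTo R n g
  sumTo-cong zero    f≈g = f≈g 0
  sumTo-cong (suc n) f≈g = +-cong (sumTo-cong n f≈g) (f≈g (suc n))

  sumTo-+ : ∀ n f g → sumTo R n (λ i → f i + g i) ≈ sumTo R n f + sumTo R n g
  sumTo-+ zero    f g = refl
  sumTo-+ (suc n) f g = begin
    sumTo R n (λ i → f i + g i) + (f (suc n) + g (suc n))
      ≈⟨ +-congʳ (sumTo-+ n f g) ⟩
    sumTo R n f + sumTo R n g + (f (suc n) + g (suc n))
      ≈⟨ solve 4 (λ F G a b → F :+ G :+ (a :+ b) := F :+ a :+ (G :+ b)) refl _ _ _ _ ⟩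
    sumTo R n f + f (suc n) + (sumTo R n g + g (suc n)) ∎

  *-distribˡ-sumTo : ∀ n a f → a * sumTo R n f ≈ sumTo R n (λ i → a * f i)
  *-distribˡ-sumTo zero    a f = refl
  *-distribˡ-sumTo (suc n) a f = trans (distribˡ a _ _) (+-congʳ (*-distribˡ-sumTo n a f))

  sumTo-suc : ∀ n f → sumTo R (suc n) f ≈ f 0 + sumTo R n (λ i → f (suc i))
  sumTo-suc zero    f = refl
  sumTo-suc (suc n) f = trans (+-congʳ (sumTo-suc n f)) (+-assoc _ _ _)

  n<k⇒gauss≈0 : ∀ p {n k} → n ℕ.< k → gauss R p n k ≈ 0#
  n<k⇒gauss≈0 p {zero}  {suc k} _         = refl
  n<k⇒gauss≈0 p {suc n} {suc k} (s≤s n<k) = begin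
    gauss R p n k + pow R p (suc k) * gauss R p n (suc k)
      ≈⟨ +-cong (n<k⇒gauss≈0 p n<k) (*-congˡ (n<k⇒gauss≈0 p (ℕ.m<n⇒m<1+n n<k))) ⟩
    0# + pow R p (suc k) * 0#
      ≈⟨ trans (+-identityˡ _) (zeroʳ _) ⟩
    0# ∎

  module RogersSzegő (p : Carrier) where

    H : ℕ → Carrier → Carrier
    H n x = sumTo R n (λ i → gauss R p n i * pow R x i)

    H-cong : ∀ n {x y} → x ≈ y → H n x ≈ H n y
    H-cong n x≈y = sumTo-cong n (λ i → *-congˡ (pow-cong i x≈y))

    H-suc : ∀ n x → H (suc n) x ≈ H n (p * x) + x * H n x
    H-suc n x = begin
      H (suc n) x
        ≈⟨ sumTo-suc n _ ⟩
      1# * 1# + sumTo R n (λ i → gauss R p (suc n) (suc i) * pow R x (suc i))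
        ≈⟨ +-congˡ (sumTo-cong n pascal) ⟩
      1# * 1# + sumTo R n (λ i → x * (gauss R p n i * pow R x i) + shifted i)
        ≈⟨ +-congˡ (sumTo-+ n _ shifted) ⟩
      1# * 1# + (sumTo R n (λ i → x * (gauss R p n i * pow R x i)) + sumTo R n shifted)
        ≈⟨ +-congˡ (+-congʳ (*-distribˡ-sumTo n x _)) ⟨
      1# * 1# + (x * H n x + sumTo R n shifted)
        ≈⟨ solve 3 (λ a b c → a :+ (b :+ c) := a :+ c :+ b) refl _ _ _ ⟩
      1# * 1# + sumTo R n shifted + x * H n x
        ≈⟨ +-congʳ (sumTo-suc n _) ⟨
      H n (p * x) + gauss R p n (suc n) * pow R (p * x) (suc n) + x * H n x
        ≈⟨ +-congʳ (+-congˡ (trans (*-congʳ (n<k⇒gauss≈0 p (ℕ.n<1+n n))) (zeroˡ _))) ⟩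
      H n (p * x) + 0# + x * H n x
        ≈⟨ +-congʳ (+-identityʳ _) ⟩
      H n (p * x) + x * H n x ∎
      where
      shifted : ℕ → Carrier
      shifted i = gauss R p n (suc i) * pow R (p * x) (suc i)

      pascal : ∀ i →
        gauss R p (suc n) (suc i) * pow R x (suc i) ≈ x * (gauss R p n i * pow R x i) + shifted i
      pascal i = begin
        (gauss R p n i + pow R p (suc i) * gauss R p n (suc i)) * (x * pow R x i)
          ≈⟨ solve 5 (λ a b c x y → (a :+ b :* c) :* (x :* y) := x :* (a :* y) :+ c :* (b :* (x :* y)))
               refl _ _ _ _ _ ⟩
        x * (gauss R p n i * pow R x i) + gauss R p n (suc i) * (pow R p (suc i) * pow R x (suc i))
          ≈⟨ +-congˡ (*-congˡ (pow-distrib-* p x (suc i))) ⟨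
        x * (gauss R p n i * pow R x i) + shifted i ∎

    H-suc-scaled : ∀ n x → H (suc n) (p * x) ≈ H n (p * x) + pow R p (suc n) * x * H n x
    H-suc-scaled zero    x = trans (H-suc 0 (p * x))
      (solve 2 (λ p x → let one = con (+ 1) in
                  one :* one :+ p :* x :* (one :* one) := one :* one :+ p :* one :* x :* (one :* one))
         refl p x)
    H-suc-scaled (suc n) x = begin
      H (2 ℕ.+ n) (p * x)
        ≈⟨ H-suc (suc n) (p * x) ⟩
      H (suc n) (p * (p * x)) + p * x * H (suc n) (p * x)
        ≈⟨ +-cong (H-suc-scaled n (p * x)) (*-congˡ (H-suc-scaled n x)) ⟩
      H n (p * (p * x)) + P * (p * x) * H n (p * x) + p * x * (H n (p * x) + P * x * H n x)
        ≈⟨ solve 6 (λ p x P a b c → c :+ P :* (p :* x) :* b :+ p :* x :* (b :+ P :* x :* a)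
                                 := c :+ p :* x :* b :+ p :* P :* x :* (b :+ x :* a))
             refl p x P (H n x) (H n (p * x)) (H n (p * (p * x))) ⟩
      H n (p * (p * x)) + p * x * H n (p * x) + p * P * x * (H n (p * x) + x * H n x)
        ≈⟨ +-cong (H-suc n (p * x)) (*-congˡ (H-suc n x)) ⟨
      H (suc n) (p * x) + pow R p (2 ℕ.+ n) * x * H (suc n) x ∎
      where P = pow R p (suc n)

    H-q-difference : ∀ n x → H (suc n) (p * x) ≈ H (suc n) x + (pow R p (suc n) - 1#) * x * H n x
    H-q-difference n x = begin
      H (suc n) (p * x)
        ≈⟨ H-suc-scaled n x ⟩
      H n (p * x) + pow R p (suc n) * x * H n x
        ≈⟨ solve 4 (λ P x a b → b :+ P :* x :* a := b :+ x :* a :+ (P :- con (+ 1)) :* x :* a)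
             refl (pow R p (suc n)) x (H n x) (H n (p * x)) ⟩
      H n (p * x) + x * H n x + (pow R p (suc n) - 1#) * x * H n x
        ≈⟨ +-congʳ (H-suc n x) ⟨
      H (suc n) x + (pow R p (suc n) - 1#) * x * H n x ∎

    H-three-term : ∀ n y →
      H (2 ℕ.+ n) (p * (p * y)) ≈
        (1# + p * y * (pow R p (2 ℕ.+ n) + pow R p (suc n) - 1#)) * H (suc n) (p * y)
        - y * y * pow R p (2 ℕ.+ n) * (pow R p (suc n) - 1#) * H n y
    H-three-term n y = begin
      H (2 ℕ.+ n) (p * (p * y))
        ≈⟨ H-suc-scaled (suc n) (p * y) ⟩
      H (suc n) (p * (p * y)) + p * P * (p * y) * H₁
        ≈⟨ +-congʳ (H-q-difference n (p * y)) ⟩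
      H₁ + (P - 1#) * (p * y) * b + p * P * (p * y) * H₁
        ≈⟨ +-cong (+-congʳ H₁≈) (*-congˡ H₁≈) ⟩
      (b + P * y * a) + (P - 1#) * (p * y) * b + p * P * (p * y) * (b + P * y * a)
        ≈⟨ solve 5 (λ p y P a b →
               (b :+ P :* y :* a) :+ (P :- con (+ 1)) :* (p :* y) :* b
                 :+ p :* P :* (p :* y) :* (b :+ P :* y :* a)
               := (con (+ 1) :+ p :* y :* (p :* P :+ P :- con (+ 1))) :* (b :+ P :* y :* a)
                  :- y :* y :* (p :* P) :* (P :- con (+ 1)) :* a)
             refl p y P a b ⟩
      (1# + p * y * (p * P + P - 1#)) * (b + P * y * a) - y * y * (p * P) * (P - 1#) * a
        ≈⟨ +-congʳ (*-congˡ H₁≈) ⟨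
      (1# + p * y * (p * P + P - 1#)) * H₁ - y * y * (p * P) * (P - 1#) * a ∎
      where
      P  = pow R p (suc n)
      a  = H n y
      b  = H n (p * y)
      H₁ = H (suc n) (p * y)
      H₁≈ : H₁ ≈ b + P * y * a
      H₁≈ = H-suc-scaled n y

    sumTo≈H : ∀ n a x y →
      sumTo R n (λ i → gauss R p n i * pow R x (a ℕ.* i) * pow R y i) ≈ H n (pow R x a * y)
    sumTo≈H n a x y = sumTo-cong n λ i → begin
      gauss R p n i * pow R x (a ℕ.* i) * pow R y i     ≈⟨ *-assoc _ _ _ ⟩
      gauss R p n i * (pow R x (a ℕ.* i) * pow R y i)   ≈⟨ *-congˡ (*-congʳ (pow-* x a i)) ⟩
      gauss R p n i * (pow R (pow R x a) i * pow R y i) ≈⟨ *-congˡ (pow-distrib-* (pow R x a) y i) ⟨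
      gauss R p n i * pow R (pow R x a * y) i           ∎

  module Convergents (q z : Carrier) where

    p : Carrier
    p = q * q

    open RogersSzegő p

    pow-double : ∀ n → pow R q (2 ℕ.* n) ≈ pow R p n
    pow-double n = trans (pow-* q 2 n) (pow-cong n (*-congˡ (*-identityʳ q)))

    cCoef-closed : ∀ n →
      cCoef R q (2 ℕ.+ n) ≈ q * pow R p n * (pow R p (2 ℕ.+ n) + pow R p (suc n) - 1#)
    cCoef-closed n = begin
      q * Y * (q * (q * (q * (q * Y))) + q * (q * Y) - 1#)
        ≈⟨ solve 2 (λ q Y → q :* Y :* (q :* (q :* (q :* (q :* Y))) :+ q :* (q :* Y) :- con (+ 1))
                        := q :* Y :* (q :* q :* (q :* q :* Y) :+ q :* q :* Y :- con (+ 1)))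
             refl q Y ⟩
      q * Y * (p * (p * Y) + p * Y - 1#)
        ≈⟨ *-cong (*-congˡ Y≈P) (+-congʳ (+-cong (*-congˡ (*-congˡ Y≈P)) (*-congˡ Y≈P))) ⟩
      q * P * (p * (p * P) + p * P - 1#) ∎
      where
      Y = pow R q (2 ℕ.* n)
      P = pow R p n
      Y≈P = pow-double n

    αCoef-closed : ∀ n →
      αCoef R q (2 ℕ.+ n) ≈ q * q * pow R (pow R p n) 3 * (pow R p (suc n) - 1#)
    αCoef-closed n = begin
      q * (q * pow R q (6 ℕ.* n)) * (q * (q * pow R q (2 ℕ.* n)) - 1#)
        ≈⟨ *-cong (*-congˡ (*-congˡ sextic)) (+-congʳ (*-congˡ (*-congˡ (pow-double n)))) ⟩
      q * (q * pow R P 3) * (q * (q * P) - 1#)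
        ≈⟨ *-cong (*-assoc q q _) (+-congʳ (*-assoc q q P)) ⟨
      q * q * pow R P 3 * (p * P - 1#) ∎
      where
      P = pow R p n
      sextic : pow R q (6 ℕ.* n) ≈ pow R P 3
      sextic = begin
        pow R q (6 ℕ.* n)          ≡⟨ ≡.cong (pow R q) (ℕ.*-assoc 2 3 n) ⟩
        pow R q (2 ℕ.* (3 ℕ.* n))  ≡⟨ ≡.cong (λ m → pow R q (2 ℕ.* m)) (ℕ.*-comm 3 n) ⟩
        pow R q (2 ℕ.* (n ℕ.* 3))  ≈⟨ pow-double (n ℕ.* 3) ⟩
        pow R p (n ℕ.* 3)          ≈⟨ pow-* p n 3 ⟩
        pow R P 3                  ∎

    y : ℕ → Carrier
    y k = q * pow R p k * - z

    y-suc : ∀ k → y (suc k) ≈ p * y k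
    y-suc k = solve 3 (λ q K z → q :* (q :* q :* K) :* :- z := q :* q :* (q :* K :* :- z))
                refl q (pow R p k) z

    Q-suc≈H : ∀ k → Q R q z (suc k) ≈ H (suc k) (y k)
    Q-suc≈H zero = solve 2 (λ q z →
        let one = con (+ 1); nil = con (+ 0) in
        one :- q :* z := one :* one :+ (one :+ q :* q :* one :* nil) :* (q :* one :* :- z :* one))
      refl q z
    -- Q 2 is computed directly: the step below would need some y₋₁ with p * y₋₁ = y 0 = q (-z).
    Q-suc≈H (suc zero) = solve 2 (λ q z →
        let one = con (+ 1); nil = con (+ 0); p = q :* q; x = q :* p :^ 1 :* :- z in
        (one :- q :^ 1 :* (q :^ 4 :+ q :^ 2 :- one) :* z) :* (one :- q :* z)
          :- q :^ 2 :* (q :^ 2 :- one) :* (z :* z) :* one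
        := one :* x :^ 0
           :+ (one :+ p :^ 1 :* (one :+ p :^ 1 :* nil)) :* x :^ 1
           :+ ((one :+ p :^ 1 :* nil) :+ p :^ 2 :* (nil :+ p :^ 2 :* nil)) :* x :^ 2)
      refl q z
    Q-suc≈H (suc (suc k)) = begin
      (1# - cCoef R q (3 ℕ.+ k) * z) * Q R q z (2 ℕ.+ k)
        - αCoef R q (3 ℕ.+ k) * (z * z) * Q R q z (suc k)
        ≈⟨ +-cong (*-cong (+-congˡ (-‿cong (*-congʳ (cCoef-closed (suc k))))) (Q-suc≈H (suc k)))
                  (-‿cong (*-cong (*-congʳ (αCoef-closed (suc k))) (Q-suc≈H k))) ⟩
      (1# - q * pow R p (suc k) * S * z) * H (2 ℕ.+ k) (y (suc k))
        - q * q * pow R (pow R p (suc k)) 3 * T * (z * z) * H (suc k) (y k)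
        ≈⟨ +-cong (*-cong linear-coefficient (H-cong (2 ℕ.+ k) (y-suc k)))
                  (-‿cong (*-congʳ quadratic-coefficient)) ⟩
      (1# + p * y k * S) * H (2 ℕ.+ k) (p * y k) - y k * y k * pow R p (3 ℕ.+ k) * T * H (suc k) (y k)
        ≈⟨ H-three-term (suc k) (y k) ⟨
      H (3 ℕ.+ k) (p * (p * y k))
        ≈⟨ H-cong (3 ℕ.+ k) (trans (y-suc (suc k)) (*-congˡ (y-suc k))) ⟨
      H (3 ℕ.+ k) (y (2 ℕ.+ k)) ∎
      where
      K = pow R p k
      S = pow R p (3 ℕ.+ k) + pow R p (2 ℕ.+ k) - 1#
      T = pow R p (2 ℕ.+ k) - 1#

      linear-coefficient : 1# - q * pow R p (suc k) * S * z ≈ 1# + p * y k * S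
      linear-coefficient = solve 4 (λ q K S z →
          con (+ 1) :- q :* (q :* q :* K) :* S :* z := con (+ 1) :+ q :* q :* (q :* K :* :- z) :* S)
        refl q K S z

      quadratic-coefficient :
        q * q * pow R (pow R p (suc k)) 3 * T * (z * z) ≈ y k * y k * pow R p (3 ℕ.+ k) * T
      quadratic-coefficient = solve 4 (λ q K T z → let pK = q :* q :* K in
          q :* q :* pK :^ 3 :* T :* (z :* z)
          := q :* K :* :- z :* (q :* K :* :- z) :* (q :* q :* (q :* q :* pK)) :* T)
        refl q K T z

    Q≈H : ∀ h → Q R q z h ≈ H h (pow R q (2 ℕ.* h ℕ.∸ 1) * - z)
    Q≈H zero    = sym (*-identityˡ 1#)
    Q≈H (suc k) = trans (Q-suc≈H k) (H-cong (suc k) (*-congʳ (begin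
      q * pow R p k                   ≈⟨ *-congˡ (pow-double k) ⟨
      pow R q (suc (2 ℕ.* k))         ≡⟨ ≡.cong (pow R q) (2[1+k]∸1≡1+2k k) ⟨
      pow R q (2 ℕ.* suc k ℕ.∸ 1)     ∎)))

mainTheorem2 : {c ℓ : Level} (R : CommutativeRing c ℓ) →
    let open CommutativeRing R in
    (q z : Carrier) → ¬ (q ≈ 0#) → ¬ (z ≈ 0#) → (h : ℕ) →
    Q R q z h ≈ sumTo R h (λ i →
      gauss R (q * q) h i * pow R q ((2 ℕ.* h ℕ.∸ 1) ℕ.* i) * pow R (- z) i)
mainTheorem2 R q z _ _ h =
  trans (Q≈H h) (sym (sumTo≈H h (2 ℕ.* h ℕ.∸ 1) q (- z)))
  where
  open CommutativeRing R using (trans; sym; -_)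
  open Convergents R q z
  open RogersSzegő R p
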